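{- The formal system ATM described in the context is consistent; that is, $\bot$ is not a theorem of ATM.
   Context: The formal system ATM is defined as follows. Terms: $\dot{\bot}$ and $L_1, L_2, L_3,\ldots$ are constant symbols, and each is a term. If $s,t$ are terms, then so are $(s\,\dot{\wedge}\,t)$, $(s\,\dot{\vee}\,t)$, $(s\,\dot{\to}\,t)$, $\dot{\mathbb{A}}[t]$, $\dot{\mathbb{T}}[t]$, $\dot{\mathbb{M}}[t]$. All terms arise this way; there are no variables. Abbreviations: $\dot{\neg}t$ is $t\,\dot{\to}\,\dot{\bot}$, and $s\,\dot{\leftrightarrow}\,t$ is $(s\,\dot{\to}\,t)\,\dot{\wedge}\,(t\,\dot{\to}\,s)$. Sentences: the atomic sentences are $\bot$ and $\mathbb{A}[t]$, $\mathbb{T}[t]$, $\mathbb{M}[t]$ for each term $t$. If $\phi,\psi$ are sentences, so are $(\phi\wedge\psi)$, $(\phi\vee\psi)$, $(\phi\to\psi)$. Abbreviations: $\neg\phi$ is $\phi\to\bot$, and $\phi\leftrightarrow\psi$ is $(\phi\to\psi)\wedge(\psi\to\phi)$. Quotation and evaluation: for a sentence $\phi$, $\dot{\phi}$ is the term obtained by putting dots on every $\bot,\wedge,\vee,\to,\mathbb{A},\mathbb{T},\mathbb{M}$ in $\phi$. Each term $t$ evaluates to a sentence $\hat{t}$: $\dot{\bot}$ evaluates to $\bot$; $\dot{\mathbb{A}}[t]$, $\dot{\mathbb{T}}[t]$, $\dot{\mathbb{M}}[t]$ evaluate to $\mathbb{A}[t]$, $\mathbb{T}[t]$, $\mathbb{M}[t]$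 respectively (with $t$ unchanged); $s\,\dot{\wedge}\,t$, $s\,\dot{\vee}\,t$, $s\,\dot{\to}\,t$ evaluate to $\hat{s}\wedge\hat{t}$, $\hat{s}\vee\hat{t}$, $\hat{s}\to\hat{t}$; and each $L_i$ evaluates to a fixed sentence $\theta_i$, where $\theta_1$ is $\neg\mathbb{T}[L_1]$, $\theta_2$ is $\neg\mathbb{A}[L_2]$, and the remaining $\theta_i$ ($i\ge 3$) are arbitrary fixed sentences. Thus $\hat{\dot{\phi}}=\phi$. Groundedness: the grounded sentences form the smallest set of sentences such that $\bot$ is grounded; $\mathbb{A}[t]$ and $\mathbb{M}[t]$ are grounded for every term $t$; if $\phi,\psi$ are grounded then so are $\phi\wedge\psi$, $\phi\vee\psi$, $\phi\to\psi$; and if $\hat{t}$ is grounded then $\mathbb{T}[t]$ is grounded. Logical axioms: all sentences $(\mathbb{M}[s]\wedge\mathbb{M}[t]\wedge\mathbb{M}[u])\to\mathbb{A}[\dot{A}(s,t,u)]$ for terms $s,t,u$, where $A$ ranges over the standard Hilbert-style axiom schemes of intuitionistic propositional logic and $\dot{A}(s,t,u)$ is the term obtained by instantiating the scheme with $s,t,u$ using the dotted connectives (e.g. $s\,\dot{\wedge}\,t\,\dot{\to}\,s$). Nonlogical axioms (for all terms $s,t,t'$): (1) $\mathbb{M}[t]$, whenever $\hat{t}$ is grounded; (2) $(\mathbb{M}[s]\wedge\mathbb{M}[t])\leftrightarrow\mathbb{M}[s\,\dot{\wedge}\,t]\leftrightarrow\mathbb{M}[s\,\dot{\vee}\,t]\leftrightarrow\mathbb{M}[s\,\dot{\to}\,t]$;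 (3) $\mathbb{A}[t]\to\mathbb{M}[t]$; (4) $(\mathbb{A}[s]\wedge\mathbb{A}[t])\to\mathbb{A}[s\,\dot{\wedge}\,t]$; (5) $(\mathbb{A}[s]\wedge\mathbb{A}[s\,\dot{\to}\,t])\to\mathbb{A}[t]$; (6) $\mathbb{M}[t]\to\mathbb{A}[t\,\dot{\to}\,\dot{\mathbb{A}}[t]]$; (7) $\mathbb{M}[t]\to\mathbb{A}[t\,\dot{\leftrightarrow}\,\dot{\mathbb{T}}[t]]$; (8) $\neg\mathbb{M}[t]\to\mathbb{A}[\dot{\neg}\dot{\mathbb{T}}[t]]$; (9) $\mathbb{M}[t]\to\mathbb{A}[t\,\dot{\leftrightarrow}\,t']$, whenever $\hat{t}=\hat{t}'$. Rules of inference: from $\phi$ and $\psi$ infer $\phi\wedge\psi$; from $\phi$ and $\phi\to\psi$ infer $\psi$ (modus ponens); from $\mathbb{A}[t]$ infer $\hat{t}$ (release). A theorem of ATM is a sentence derivable from the axioms by these rules. -}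

module Defs where

open import Data.Nat using (ℕ; zero; suc)
open import Relation.Binary.PropositionalEquality using (_≡_)

-- Terms of ATM.  The constant L_{i} is represented by  L (i ∸ 1),
-- i.e.  L 0 = L_1,  L 1 = L_2,  L (suc (suc n)) = L_{n+3}.
infixr 6 _∧̇_
infixr 5 _∨̇_
infixr 4 _→̇_
data Term : Set where
  ⊥̇    : Term
  L    : ℕ → Term
  _∧̇_  : Term → Term → Term
  _∨̇_  : Term → Term → Term
  _→̇_  : Term → Term → Term
  𝔸̇    : Term → Term
  𝕋̇    : Term → Term
  𝕄̇    : Term → Term

¬̇_ : Term → Term
¬̇ t = t →̇ ⊥̇

_↔̇_ : Term → Term → Term
s ↔̇ t = (s →̇ t) ∧̇ (t →̇ s)

infixr 6 _∧ˢ_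
infixr 5 _∨ˢ_
infixr 4 _→ˢ_
data Sentence : Set where
  ⊥ˢ   : Sentence
  𝔸    : Term → Sentence
  𝕋    : Term → Sentence
  𝕄    : Term → Sentence
  _∧ˢ_ : Sentence → Sentence → Sentence
  _∨ˢ_ : Sentence → Sentence → Sentence
  _→ˢ_ : Sentence → Sentence → Sentence

¬ˢ_ : Sentence → Sentence
¬ˢ φ = φ →ˢ ⊥ˢ

_↔ˢ_ : Sentence → Sentence → Sentence
φ ↔ˢ ψ = (φ →ˢ ψ) ∧ˢ (ψ →ˢ φ)

quote' : Sentence → Term
quote' ⊥ˢ = ⊥̇
quote' (𝔸 t) = 𝔸̇ t
quote' (𝕋 t) = 𝕋̇ t
quote' (𝕄 t) = 𝕄̇ t
quote' (φ ∧ˢ ψ) = quote' φ ∧̇ quote' ψ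
quote' (φ ∨ˢ ψ) = quote' φ ∨̇ quote' ψ
quote' (φ →ˢ ψ) = quote' φ →̇ quote' ψ

-- Evaluation t ↦ t̂, parametrised by the arbitrary fixed sentences
-- θ n = θ_{n+3}  (n ≥ 0).  θ_1 = ¬𝕋[L_1],  θ_2 = ¬𝔸[L_2].
eval : (ℕ → Sentence) → Term → Sentence
eval θ ⊥̇ = ⊥ˢ
eval θ (L zero) = ¬ˢ 𝕋 (L zero)
eval θ (L (suc zero)) = ¬ˢ 𝔸 (L (suc zero))
eval θ (L (suc (suc n))) = θ n
eval θ (s ∧̇ t) = eval θ s ∧ˢ eval θ t
eval θ (s ∨̇ t) = eval θ s ∨ˢ eval θ t
eval θ (s →̇ t) = eval θ s →ˢ eval θ t
eval θ (𝔸̇ t) = 𝔸 t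
eval θ (𝕋̇ t) = 𝕋 t
eval θ (𝕄̇ t) = 𝕄 t

data Grounded (θ : ℕ → Sentence) : Sentence → Set where
  g⊥ : Grounded θ ⊥ˢ
  g𝔸 : ∀ t → Grounded θ (𝔸 t)
  g𝕄 : ∀ t → Grounded θ (𝕄 t)
  g∧ : ∀ {φ ψ} → Grounded θ φ → Grounded θ ψ → Grounded θ (φ ∧ˢ ψ)
  g∨ : ∀ {φ ψ} → Grounded θ φ → Grounded θ ψ → Grounded θ (φ ∨ˢ ψ)
  g→ : ∀ {φ ψ} → Grounded θ φ → Grounded θ ψ → Grounded θ (φ →ˢ ψ)
  g𝕋 : ∀ t → Grounded θ (eval θ t) → Grounded θ (𝕋 t)

data IPCScheme : Term → Term → Term → Term → Set where
  ax-K    : ∀ s t u → IPCScheme s t u (s →̇ (t →̇ s))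
  ax-S    : ∀ s t u → IPCScheme s t u ((s →̇ (t →̇ u)) →̇ ((s →̇ t) →̇ (s →̇ u)))
  ax-∧E₁  : ∀ s t u → IPCScheme s t u ((s ∧̇ t) →̇ s)
  ax-∧E₂  : ∀ s t u → IPCScheme s t u ((s ∧̇ t) →̇ t)
  ax-∧I   : ∀ s t u → IPCScheme s t u (s →̇ (t →̇ (s ∧̇ t)))
  ax-∨I₁  : ∀ s t u → IPCScheme s t u (s →̇ (s ∨̇ t))
  ax-∨I₂  : ∀ s t u → IPCScheme s t u (t →̇ (s ∨̇ t))
  ax-∨E   : ∀ s t u → IPCScheme s t u ((s →̇ u) →̇ ((t →̇ u) →̇ ((s ∨̇ t) →̇ u)))
  ax-EFQ  : ∀ s t u → IPCScheme s t u (⊥̇ →̇ s)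

data Axiom (θ : ℕ → Sentence) : Sentence → Set where
  logical : ∀ {s t u a} → IPCScheme s t u a →
            Axiom θ ((𝕄 s ∧ˢ 𝕄 t ∧ˢ 𝕄 u) →ˢ 𝔸 a)
  ax1  : ∀ t → Grounded θ (eval θ t) → Axiom θ (𝕄 t)
  -- (2): the chain  a ↔ b ↔ c ↔ d  read as a↔b, b↔c, c↔d
  ax2a : ∀ s t → Axiom θ ((𝕄 s ∧ˢ 𝕄 t) ↔ˢ 𝕄 (s ∧̇ t))
  ax2b : ∀ s t → Axiom θ (𝕄 (s ∧̇ t) ↔ˢ 𝕄 (s ∨̇ t))
  ax2c : ∀ s t → Axiom θ (𝕄 (s ∨̇ t) ↔ˢ 𝕄 (s →̇ t))
  ax3  : ∀ t → Axiom θ (𝔸 t →ˢ 𝕄 t)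
  ax4  : ∀ s t → Axiom θ ((𝔸 s ∧ˢ 𝔸 t) →ˢ 𝔸 (s ∧̇ t))
  ax5  : ∀ s t → Axiom θ ((𝔸 s ∧ˢ 𝔸 (s →̇ t)) →ˢ 𝔸 t)
  ax6  : ∀ t → Axiom θ (𝕄 t →ˢ 𝔸 (t →̇ 𝔸̇ t))
  ax7  : ∀ t → Axiom θ (𝕄 t →ˢ 𝔸 (t ↔̇ 𝕋̇ t))
  ax8  : ∀ t → Axiom θ ((¬ˢ 𝕄 t) →ˢ 𝔸 (¬̇ 𝕋̇ t))
  ax9  : ∀ t t' → eval θ t ≡ eval θ t' → Axiom θ (𝕄 t →ˢ 𝔸 (t ↔̇ t'))

data Theorem (θ : ℕ → Sentence) : Sentence → Set where
  axiom   : ∀ {φ} → Axiom θ φ → Theorem θ φ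
  ∧-intro : ∀ {φ ψ} → Theorem θ φ → Theorem θ ψ → Theorem θ (φ ∧ˢ ψ)
  mp      : ∀ {φ ψ} → Theorem θ φ → Theorem θ (φ →ˢ ψ) → Theorem θ ψ
  release : ∀ {t} → Theorem θ (𝔸 t) → Theorem θ (eval θ t)

{-# OPTIONS --safe #-}
-- Interpret sentences in a Kripke-style model whose worlds are the levels
-- k ∈ ℕ, level k seeing every j ≤ k.  𝔸[t] holds at level k when t is
-- meaningful there and t̂ holds at every level below k, so release moves one
-- level down, and every axiom is forced at every level.  At level 0 every 𝕄[t]
-- and 𝔸[t] holds, so ¬𝕄[t] is never forced (axiom (8) is vacuous), while ⊥ is
-- not forced at level 0.
module Submission where

open import Defs
open import Data.Nat using (ℕ; zero; suc; _≤′_; _<′_; ≤′-refl; ≤′-step)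
open import Data.Nat.Properties using (≤′-trans; z≤′n)
open import Data.Empty using (⊥; ⊥-elim)
open import Data.Unit using (⊤; tt)
open import Data.Product as Product using (_×_; _,_; proj₁; proj₂)
open import Data.Sum as Sum using (_⊎_; inj₁; inj₂; [_,_])
open import Function using (_∘_)
open import Relation.Nullary using (¬_; Irrelevant)
open import Relation.Binary.PropositionalEquality using (refl; cong; cong₂; subst; sym)

module _ {θ : ℕ → Sentence} where

  grounded-irrelevant : ∀ {φ} → Irrelevant (Grounded θ φ)
  grounded-irrelevant g⊥       g⊥        = refl
  grounded-irrelevant (g𝔸 t)   (g𝔸 .t)   = refl
  grounded-irrelevant (g𝕄 t)   (g𝕄 .t)   = refl
  grounded-irrelevant (g∧ a b) (g∧ c d)  = cong₂ g∧ (grounded-irrelevant a c) (grounded-irrelevant b d)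
  grounded-irrelevant (g∨ a b) (g∨ c d)  = cong₂ g∨ (grounded-irrelevant a c) (grounded-irrelevant b d)
  grounded-irrelevant (g→ a b) (g→ c d)  = cong₂ g→ (grounded-irrelevant a c) (grounded-irrelevant b d)
  grounded-irrelevant (g𝕋 t a) (g𝕋 .t b) = cong (g𝕋 t) (grounded-irrelevant a b)

module Forcing (θ : ℕ → Sentence) where

  infix 3 _⊩𝕄_ _⊩_ _⊩ᵍ_ _⊩<_

  _⊩𝕄_ : ℕ → Term → Set
  zero  ⊩𝕄 t = ⊤
  suc k ⊩𝕄 t = Grounded θ (eval θ t)

  -- t̂ is not a subterm of 𝕋[t], so 𝕋[t] is interpreted by recursion along a
  -- grounding derivation of t̂ (unique, by grounded-irrelevant).  "At every
  -- level below k" is the recursion _⊩<_ rather than a quantifier over j <′ k,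
  -- which the termination checker could not follow; thus an implication is
  -- forced at k when it holds locally at k and is forced at every lower level.
  mutual
    _⊩_ : ℕ → Sentence → Set
    k ⊩ ⊥ˢ      = ⊥
    k ⊩ 𝔸 t     = k ⊩𝕄 t × k ⊩< eval θ t
    k ⊩ 𝕋 t     = (g : Grounded θ (eval θ t)) → k ⊩ᵍ g
    k ⊩ 𝕄 t     = k ⊩𝕄 t
    k ⊩ φ ∧ˢ ψ  = k ⊩ φ × k ⊩ ψ
    k ⊩ φ ∨ˢ ψ  = k ⊩ φ ⊎ k ⊩ ψ
    k ⊩ φ →ˢ ψ  = (k ⊩ φ → k ⊩ ψ) × k ⊩< φ →ˢ ψ

    _⊩ᵍ_ : ℕ → {φ : Sentence} → Grounded θ φ → Set
    k ⊩ᵍ g⊥             = ⊥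
    k ⊩ᵍ g𝔸 t           = k ⊩𝕄 t × k ⊩< eval θ t
    k ⊩ᵍ g𝕄 t           = k ⊩𝕄 t
    k ⊩ᵍ g∧ a b         = k ⊩ᵍ a × k ⊩ᵍ b
    k ⊩ᵍ g∨ a b         = k ⊩ᵍ a ⊎ k ⊩ᵍ b
    k ⊩ᵍ g→ {φ} {ψ} a b = (k ⊩ᵍ a → k ⊩ᵍ b) × k ⊩< φ →ˢ ψ
    k ⊩ᵍ g𝕋 t g         = k ⊩ᵍ g

    _⊩<_ : ℕ → Sentence → Set
    zero  ⊩< φ = ⊤
    suc k ⊩< φ = k ⊩ φ × k ⊩< φ

  Valid : Sentence → Set
  Valid φ = ∀ k → k ⊩ φ

  ⊩𝕄-intro : ∀ {k t} → Grounded θ (eval θ t) → k ⊩𝕄 t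
  ⊩𝕄-intro {zero}  g = tt
  ⊩𝕄-intro {suc k} g = g

  mutual
    ⊩⇒⊩ᵍ : ∀ {k φ} (g : Grounded θ φ) → k ⊩ φ → k ⊩ᵍ g
    ⊩⇒⊩ᵍ g⊥         x       = x
    ⊩⇒⊩ᵍ (g𝔸 t)     x       = x
    ⊩⇒⊩ᵍ (g𝕄 t)     x       = x
    ⊩⇒⊩ᵍ (g∧ a b)   x       = Product.map (⊩⇒⊩ᵍ a) (⊩⇒⊩ᵍ b) x
    ⊩⇒⊩ᵍ (g∨ a b)   x       = Sum.map (⊩⇒⊩ᵍ a) (⊩⇒⊩ᵍ b) x
    ⊩⇒⊩ᵍ (g→ a b)   (f , r) = ⊩⇒⊩ᵍ b ∘ f ∘ ⊩ᵍ⇒⊩ a , r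
    ⊩⇒⊩ᵍ (g𝕋 t g)   h       = h g

    ⊩ᵍ⇒⊩ : ∀ {k φ} (g : Grounded θ φ) → k ⊩ᵍ g → k ⊩ φ
    ⊩ᵍ⇒⊩ g⊥         x       = x
    ⊩ᵍ⇒⊩ (g𝔸 t)     x       = x
    ⊩ᵍ⇒⊩ (g𝕄 t)     x       = x
    ⊩ᵍ⇒⊩ (g∧ a b)   x       = Product.map (⊩ᵍ⇒⊩ a) (⊩ᵍ⇒⊩ b) x
    ⊩ᵍ⇒⊩ (g∨ a b)   x       = Sum.map (⊩ᵍ⇒⊩ a) (⊩ᵍ⇒⊩ b) x
    ⊩ᵍ⇒⊩ (g→ a b)   (f , r) = ⊩ᵍ⇒⊩ b ∘ f ∘ ⊩⇒⊩ᵍ a , r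
    ⊩ᵍ⇒⊩ {k} (g𝕋 t g) x g′  = subst (k ⊩ᵍ_) (grounded-irrelevant g g′) x

  ⊩-𝕋-intro : ∀ {k} t → k ⊩ eval θ t → k ⊩ 𝕋 t
  ⊩-𝕋-intro t x g = ⊩⇒⊩ᵍ g x

  ⊩-𝕋-elim : ∀ {k} t → Grounded θ (eval θ t) → k ⊩ 𝕋 t → k ⊩ eval θ t
  ⊩-𝕋-elim t g h = ⊩ᵍ⇒⊩ g (h g)

  ⊩ᵍ-pred : ∀ {k φ} (g : Grounded θ φ) → suc k ⊩ᵍ g → k ⊩ᵍ g
  ⊩ᵍ-pred g⊥         x               = x
  ⊩ᵍ-pred (g𝔸 t)     (m , _ , below) = ⊩𝕄-intro m , below
  ⊩ᵍ-pred (g𝕄 t)     m               = ⊩𝕄-intro m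
  ⊩ᵍ-pred (g∧ a b)   x               = Product.map (⊩ᵍ-pred a) (⊩ᵍ-pred b) x
  ⊩ᵍ-pred (g∨ a b)   x               = Sum.map (⊩ᵍ-pred a) (⊩ᵍ-pred b) x
  ⊩ᵍ-pred (g→ a b)   (_ , below , _) = ⊩⇒⊩ᵍ (g→ a b) below
  ⊩ᵍ-pred (g𝕋 t g)   x               = ⊩ᵍ-pred g x

  ⊩-pred : ∀ {k} φ → suc k ⊩ φ → k ⊩ φ
  ⊩-pred ⊥ˢ        x               = x
  ⊩-pred (𝔸 t)     (m , _ , below) = ⊩𝕄-intro m , below
  ⊩-pred (𝕋 t)     h               = λ g → ⊩ᵍ-pred g (h g)
  ⊩-pred (𝕄 t)     m               = ⊩𝕄-intro m
  ⊩-pred (φ ∧ˢ ψ)  x               = Product.map (⊩-pred φ) (⊩-pred ψ) x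
  ⊩-pred (φ ∨ˢ ψ)  x               = Sum.map (⊩-pred φ) (⊩-pred ψ) x
  ⊩-pred (φ →ˢ ψ)  (_ , below , _) = below

  ⊩-mono : ∀ {j k} φ → j ≤′ k → k ⊩ φ → j ⊩ φ
  ⊩-mono φ ≤′-refl       x = x
  ⊩-mono φ (≤′-step j≤k) x = ⊩-mono φ j≤k (⊩-pred φ x)

  ⊩<-intro : ∀ {k φ} → (∀ j → j <′ k → j ⊩ φ) → k ⊩< φ
  ⊩<-intro {zero}  h = tt
  ⊩<-intro {suc k} h = h k ≤′-refl , ⊩<-intro λ j j<k → h j (≤′-step j<k)

  ⊩<-elim : ∀ {j k φ} → k ⊩< φ → j <′ k → j ⊩ φ
  ⊩<-elim (x , _)     ≤′-refl       = x
  ⊩<-elim (_ , below) (≤′-step j<k) = ⊩<-elim below j<k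

  ⊩⇒⊩< : ∀ {k} φ → k ⊩ φ → k ⊩< φ
  ⊩⇒⊩< φ x = ⊩<-intro λ j j<k → ⊩-mono φ (≤′-trans (≤′-step ≤′-refl) j<k) x

  ⊩-→-intro : ∀ {k φ ψ} → (∀ j → j ≤′ k → j ⊩ φ → j ⊩ ψ) → k ⊩ φ →ˢ ψ
  ⊩-→-intro {zero}  h = h zero ≤′-refl , tt
  ⊩-→-intro {suc k} {φ} {ψ} h = h (suc k) ≤′-refl , below , proj₂ below
    where
      below : k ⊩ φ →ˢ ψ
      below = ⊩-→-intro λ j j≤k → h j (≤′-step j≤k)

  ⊩-→-elim : ∀ {j k φ ψ} → k ⊩ φ →ˢ ψ → j ≤′ k → j ⊩ φ → j ⊩ ψ
  ⊩-→-elim (f , _)         ≤′-refl       = f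
  ⊩-→-elim (_ , below , _) (≤′-step j≤k) = ⊩-→-elim below j≤k

  valid-→ : ∀ {φ ψ} → (∀ k → k ⊩ φ → k ⊩ ψ) → Valid (φ →ˢ ψ)
  valid-→ h k = ⊩-→-intro λ j _ → h j

  valid-↔ : ∀ {φ ψ} → (∀ k → k ⊩ φ → k ⊩ ψ) → (∀ k → k ⊩ ψ → k ⊩ φ) → Valid (φ ↔ˢ ψ)
  valid-↔ f g k = valid-→ f k , valid-→ g k

  valid-→𝔸 : ∀ {φ a} → (∀ k → suc k ⊩ φ → suc k ⊩ 𝔸 a) → Valid (φ →ˢ 𝔸 a)
  valid-→𝔸 h = valid-→ λ where
    zero    _ → tt , tt
    (suc k) x → h k x

  ipc-grounded : ∀ {s t u a} → IPCScheme s t u a →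
                 Grounded θ (eval θ s) → Grounded θ (eval θ t) → Grounded θ (eval θ u) →
                 Grounded θ (eval θ a)
  ipc-grounded (ax-K s t u)   gs gt gu = g→ gs (g→ gt gs)
  ipc-grounded (ax-S s t u)   gs gt gu = g→ (g→ gs (g→ gt gu)) (g→ (g→ gs gt) (g→ gs gu))
  ipc-grounded (ax-∧E₁ s t u) gs gt gu = g→ (g∧ gs gt) gs
  ipc-grounded (ax-∧E₂ s t u) gs gt gu = g→ (g∧ gs gt) gt
  ipc-grounded (ax-∧I s t u)  gs gt gu = g→ gs (g→ gt (g∧ gs gt))
  ipc-grounded (ax-∨I₁ s t u) gs gt gu = g→ gs (g∨ gs gt)
  ipc-grounded (ax-∨I₂ s t u) gs gt gu = g→ gt (g∨ gs gt)
  ipc-grounded (ax-∨E s t u)  gs gt gu = g→ (g→ gs gu) (g→ (g→ gt gu) (g→ (g∨ gs gt) gu))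
  ipc-grounded (ax-EFQ s t u) gs gt gu = g→ g⊥ gs

  ipc-valid : ∀ {s t u a} → IPCScheme s t u a → Valid (eval θ a)
  ipc-valid (ax-K s t u)   k = ⊩-→-intro λ j _ x → ⊩-→-intro λ i i≤j _ → ⊩-mono (eval θ s) i≤j x
  ipc-valid (ax-S s t u)   k = ⊩-→-intro λ j _ f → ⊩-→-intro λ i i≤j g → ⊩-→-intro λ l l≤i x →
    ⊩-→-elim (⊩-→-elim f (≤′-trans l≤i i≤j) x) ≤′-refl (⊩-→-elim g l≤i x)
  ipc-valid (ax-∧E₁ s t u) k = ⊩-→-intro λ _ _ → proj₁
  ipc-valid (ax-∧E₂ s t u) k = ⊩-→-intro λ _ _ → proj₂
  ipc-valid (ax-∧I s t u)  k = ⊩-→-intro λ j _ x → ⊩-→-intro λ i i≤j y → ⊩-mono (eval θ s) i≤j x , y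
  ipc-valid (ax-∨I₁ s t u) k = ⊩-→-intro λ _ _ → inj₁
  ipc-valid (ax-∨I₂ s t u) k = ⊩-→-intro λ _ _ → inj₂
  ipc-valid (ax-∨E s t u)  k = ⊩-→-intro λ j _ f → ⊩-→-intro λ i i≤j g → ⊩-→-intro λ l l≤i →
    [ ⊩-→-elim f (≤′-trans l≤i i≤j) , ⊩-→-elim g l≤i ]
  ipc-valid (ax-EFQ s t u) k = ⊩-→-intro λ _ _ ()

  axiom-valid : ∀ {φ} → Axiom θ φ → Valid φ
  axiom-valid (logical sc) = valid-→𝔸 λ _ (ms , mt , mu) →
    ipc-grounded sc ms mt mu , ⊩<-intro λ j _ → ipc-valid sc j
  axiom-valid (ax1 t g) k = ⊩𝕄-intro g
  axiom-valid (ax2a s t) = valid-↔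
    (λ { zero _ → tt ; (suc _) (a , b) → g∧ a b })
    (λ { zero _ → tt , tt ; (suc _) (g∧ a b) → a , b })
  axiom-valid (ax2b s t) = valid-↔
    (λ { zero _ → tt ; (suc _) (g∧ a b) → g∨ a b })
    (λ { zero _ → tt ; (suc _) (g∨ a b) → g∧ a b })
  axiom-valid (ax2c s t) = valid-↔
    (λ { zero _ → tt ; (suc _) (g∨ a b) → g→ a b })
    (λ { zero _ → tt ; (suc _) (g→ a b) → g∨ a b })
  axiom-valid (ax3 t) = valid-→ λ _ → proj₁
  axiom-valid (ax4 s t) = valid-→𝔸 λ _ ((ms , s-below) , (mt , t-below)) →
    g∧ ms mt , ⊩<-intro λ j j<k → ⊩<-elim s-below j<k , ⊩<-elim t-below j<k
  axiom-valid (ax5 s t) = valid-→𝔸 λ { _ ((_ , s-below) , (g→ _ mt , s→t-below)) →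
    mt , ⊩<-intro λ j j<k → ⊩-→-elim (⊩<-elim s→t-below j<k) ≤′-refl (⊩<-elim s-below j<k) }
  axiom-valid (ax6 t) = valid-→𝔸 λ _ m →
    g→ m (g𝔸 t) , ⊩<-intro λ _ _ → ⊩-→-intro λ _ _ x → ⊩𝕄-intro m , ⊩⇒⊩< (eval θ t) x
  axiom-valid (ax7 t) = valid-→𝔸 λ _ m →
    g∧ (g→ m (g𝕋 t m)) (g→ (g𝕋 t m) m) ,
    ⊩<-intro λ j _ → valid-↔ (λ _ → ⊩-𝕋-intro t) (λ _ → ⊩-𝕋-elim t m) j
  axiom-valid (ax8 t) = valid-→ λ _ ¬m → ⊥-elim (⊩-→-elim ¬m z≤′n tt)
  axiom-valid (ax9 t t′ eq) = valid-→𝔸 λ _ m →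
    g∧ (g→ m (subst (Grounded θ) eq m)) (g→ (subst (Grounded θ) eq m) m) ,
    ⊩<-intro λ j _ → valid-↔ (λ i → subst (i ⊩_) eq) (λ i → subst (i ⊩_) (sym eq)) j

  theorem-valid : ∀ {φ} → Theorem θ φ → Valid φ
  theorem-valid (axiom a)     k = axiom-valid a k
  theorem-valid (∧-intro d e) k = theorem-valid d k , theorem-valid e k
  theorem-valid (mp d e)      k = ⊩-→-elim (theorem-valid e k) ≤′-refl (theorem-valid d k)
  theorem-valid (release d)   k = let (_ , t̂-at-k , _) = theorem-valid d (suc k) in t̂-at-k

theorem4p1 : (θ : ℕ → Sentence) → ¬ Theorem θ ⊥ˢ
theorem4p1 θ d = Forcing.theorem-valid θ d zero
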